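{- Let $G$ be a graph with an effective competition cover $\mathcal{C}$. Then the cliques of $\mathcal{C}$ can be labeled $C_1,\dots,C_{\theta_e(G)}$ so that for every $1\le k\le \theta_e(G)$, $$p(G)\ \ge\ \Bigl|\bigcup_{i=k}^{\theta_e(G)} C_i\Bigr| - \theta_e(G) + k.$$
   Context: All graphs are finite and simple; digraphs are finite, without loops or multiple arcs. A clique is a vertex set inducing a complete subgraph; it covers an edge if it contains both ends. The competition graph $C(D)$ of a digraph $D$ has vertex set $V(D)$, and distinct $x,y$ are adjacent iff some $z$ has arcs $(x,z),(y,z)$ in $D$. The competition number $k(G)$ is the smallest $k\ge0$ such that $G$ together with $k$ new isolated vertices is the competition graph of an acyclic digraph. The primary predator index $p(G)$ is the maximum, over all acyclic digraphs $D$ whose competition graph is $G$ together with $k(G)$ isolated vertices, of the number of in-degree-$0$ vertices of $D$. An edge clique cover is a family of cliques covering all edges; $\theta_e(G)$ is the minimum size of one; a minimum edge clique cover has size $\theta_e(G)$. For $G$ with at least one edge, a minimum edge clique cover $\mathcal{C}=\{C_1,\dots,C_{\theta_e(G)}\}$ is an effective competition cover if every $C_i$ is a maximal clique and there is an acyclic digraph $D$ whose competition graph is $G$ together with $k(G)$ isolated vertices, such that the set of vertices of nonzero in-degree of $D$ is $\{w_1,\dots,w_{\theta_e(G)}\}$ where each $w_i$ is a common out-neighbor of all vertices of $C_i$. -}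

module Defs where

open import Data.Nat using (ℕ; _≤_; _+_)
open import Data.Bool using (Bool; true; false)
open import Data.Bool.Properties using () renaming (_≟_ to _≟ᵇ_)
open import Data.Fin using (Fin; splitAt; _↑ˡ_; _≤?_)
open import Data.Fin.Properties using (all?)
open import Data.Fin.Subset using (Subset; _∈_; _⊆_; ⋃; ∣_∣)
open import Data.List using (List; length; filter; map; allFin)
open import Data.Sum using (inj₁; inj₂)
open import Data.Product using (Σ; ∃; _×_; _,_)
open import Function.Bundles using (_⇔_)
open import Relation.Nullary using (¬_)
open import Relation.Binary.PropositionalEquality using (_≡_; _≢_)
open import Relation.Binary.Construct.Closure.Transitive using (TransClosure)

record Graph (n : ℕ) : Set where
  field
    Adj     : Fin n → Fin n → Bool
    sym     : ∀ x y → Adj x y ≡ Adj y x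
    irrefl  : ∀ x → Adj x x ≡ false
open Graph public

record Digraph (m : ℕ) : Set where
  field
    Arc      : Fin m → Fin m → Bool
    loopless : ∀ x → Arc x x ≡ false
open Digraph public

ArcRel : ∀ {m} → Digraph m → Fin m → Fin m → Set
ArcRel D x y = Arc D x y ≡ true

Acyclic : ∀ {m} → Digraph m → Set
Acyclic D = ∀ x → ¬ TransClosure (ArcRel D) x x

-- adjacency of G together with k new isolated vertices (vertices Fin (n + k);
-- the first n are the vertices of G, via _↑ˡ_)
AdjIso : ∀ {n} → Graph n → (k : ℕ) → Fin (n + k) → Fin (n + k) → Bool
AdjIso {n} G k x y with splitAt n x | splitAt n y
... | inj₁ i | inj₁ j = Adj G i j
... | inj₁ _ | inj₂ _ = false
... | inj₂ _ | _      = false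

IsCompGraphOf : ∀ {n} → Graph n → (k : ℕ) → Digraph (n + k) → Set
IsCompGraphOf G k D = ∀ x y → x ≢ y →
  (AdjIso G k x y ≡ true ⇔ ∃ λ z → ArcRel D x z × ArcRel D y z)

Realizes : ∀ {n} → Graph n → (k : ℕ) → Digraph (n + k) → Set
Realizes G k D = Acyclic D × IsCompGraphOf G k D

CompRealizable : ∀ {n} → Graph n → ℕ → Set
CompRealizable G k = Σ (Digraph _) (Realizes G k)

IsCompetitionNumber : ∀ {n} → Graph n → ℕ → Set
IsCompetitionNumber G k = CompRealizable G k × (∀ k′ → CompRealizable G k′ → k ≤ k′)

InDegZero : ∀ {m} → Digraph m → Fin m → Set
InDegZero D v = ∀ x → Arc D x v ≡ false

numInDegZero : ∀ {m} → Digraph m → ℕ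
numInDegZero {m} D = length (filter (λ v → all? (λ x → Arc D x v ≟ᵇ false)) (allFin m))

IsPrimaryPredatorIndex : ∀ {n} → Graph n → (k : ℕ) → ℕ → Set
IsPrimaryPredatorIndex G k p =
  IsCompetitionNumber G k ×
  (Σ (Digraph _) λ D → Realizes G k D × numInDegZero D ≡ p) ×
  (∀ D → Realizes G k D → numInDegZero D ≤ p)

IsClique : ∀ {n} → Graph n → Subset n → Set
IsClique G C = ∀ x y → x ∈ C → y ∈ C → x ≢ y → Adj G x y ≡ true

IsMaximalClique : ∀ {n} → Graph n → Subset n → Set
IsMaximalClique G C = IsClique G C × (∀ C′ → IsClique G C′ → C ⊆ C′ → C′ ⊆ C)

IsEdgeCliqueCover : ∀ {n} → Graph n → (t : ℕ) → (Fin t → Subset n) → Set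
IsEdgeCliqueCover G t C =
  (∀ i → IsClique G (C i)) ×
  (∀ x y → Adj G x y ≡ true → ∃ λ i → x ∈ C i × y ∈ C i)

IsMinEdgeCliqueCover : ∀ {n} → Graph n → (t : ℕ) → (Fin t → Subset n) → Set
IsMinEdgeCliqueCover {n} G t C =
  IsEdgeCliqueCover G t C × (∀ s (C′ : Fin s → Subset n) → IsEdgeCliqueCover G s C′ → t ≤ s)

HasEdge : ∀ {n} → Graph n → Set
HasEdge G = ∃ λ x → ∃ λ y → Adj G x y ≡ true

NonzeroInDeg : ∀ {m} → Digraph m → Fin m → Set
NonzeroInDeg D v = ∃ λ x → ArcRel D x v

IsEffectiveCompetitionCover : ∀ {n} → Graph n → (k t : ℕ) → (Fin t → Subset n) → Set
IsEffectiveCompetitionCover {n} G k t C =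
  HasEdge G × IsMinEdgeCliqueCover G t C × (∀ i → IsMaximalClique G (C i)) ×
  (Σ (Digraph (n + k)) λ D → Realizes G k D ×
    (Σ (Fin t → Fin (n + k)) λ w →
      (∀ i x → x ∈ C i → ArcRel D (x ↑ˡ k) (w i)) ×
      (∀ v → NonzeroInDeg D v ⇔ ∃ λ i → v ≡ w i)))

-- ⋃_{i ≥ k} C i  (0-based index k : Fin t)
unionFrom : ∀ {n t} → (Fin t → Subset n) → Fin t → Subset n
unionFrom {t = t} C k = ⋃ (map C (filter (λ i → k ≤? i) (allFin t)))

module Submission where

-- Let D realise G ∪ I_k with prey vertices w₁,…,w_t, where wᵢ is a
-- common out-neighbour of the clique Cᵢ and the wᵢ are exactly the vertices of
-- nonzero in-degree.  The arcs of D between prey vertices form an acyclic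
-- relation on the indices, so the indices can be ordered topologically:
-- σ is a permutation with  w_{σa} → w_{σb}  only when b < a.
-- Now fix j and let x lie in some C_{σi} with i ≥ j.  Either x has in-degree 0
-- in D, or x is a prey vertex w_{σa}; in the latter case the arc x → w_{σi}
-- forces i < a, hence j < a.  So the union U of the C_{σi}, i ≥ j, embeds into
-- the list of in-degree-0 vertices of D followed by the t - (j+1) prey vertices
-- w_{σa}, a > j, and therefore
--     |U| ≤ #(in-degree-0 vertices of D) + t - (j+1) ≤ p(G) + t - (j+1).

open import Defs hiding (sym)
open import Data.Nat using (ℕ; zero; suc; _+_; _≤_; z≤n; s≤s)
import Data.Nat.Properties as ℕ
open import Data.Bool using (true; false)
open import Data.Bool.Properties using (¬-not) renaming (_≟_ to _≟ᵇ_)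
open import Data.Fin using (Fin; toℕ; _↑ˡ_; _<_; _≤?_; _<?_) renaming (_≤_ to _≤ᶠ_)
import Data.Fin.Properties as FinP
open FinP using (pigeonhole; all?; any?; ¬∀⟶∃¬; ↑ˡ-injective)
open import Data.Fin.Permutation using (Permutation′; _⟨$⟩ʳ_; _⟨$⟩ˡ_; inverseʳ; lift₀; transpose; _∘ₚ_)
  renaming (id to idₚ)
open import Data.Fin.Subset using (Subset; _∈_; ⋃; ∣_∣; inside; outside)
open import Data.Fin.Subset.Properties using (x∈p∪q⁻; ∉⊥)
open import Data.Vec using ([]; _∷_; here; there)
open import Data.List as List using (List; length; filter; map; allFin; tabulate; _++_)
open import Data.List.Properties using (length-removeAt′; length-++; length-map)
import Data.List.Relation.Unary.Any as Any
open Any using (_─_)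
open import Data.List.Membership.Propositional using () renaming (_∈_ to _∈ₗ_)
open import Data.List.Membership.Propositional.Properties
  using (∈-allFin; ∈-filter⁺; ∈-filter⁻; ∈-map⁺; ∈-map⁻; ∈-++⁺ˡ; ∈-++⁺ʳ)
open import Data.Product using (Σ; ∃; _×_; _,_; proj₁; proj₂)
open import Data.Sum using (_⊎_; inj₁; inj₂)
open import Data.Empty using (⊥-elim)
open import Function using (_∘_; id)
open import Function.Definitions using (Injective)
open import Function.Bundles using (Equivalence; _⇔_)
open import Relation.Nullary using (¬_; yes; no; ¬?; does)
open import Relation.Nullary.Decidable using (decidable-stable)
open import Relation.Binary using (Decidable)
open import Relation.Binary.PropositionalEquality using (_≡_; _≢_; refl; sym; trans; cong; subst)
open import Relation.Binary.Construct.Closure.Transitive using (TransClosure; [_]; _∷_; _∷ʳ_)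

IsAcyclic : ∀ {A : Set} → (A → A → Set) → Set
IsAcyclic R = ∀ x → ¬ TransClosure R x x

TransClosure-map : ∀ {A B : Set} {R : A → A → Set} {S : B → B → Set} (f : A → B) →
  (∀ {x y} → R x y → S (f x) (f y)) → ∀ {x y} → TransClosure R x y → TransClosure S (f x) (f y)
TransClosure-map f h [ r ]    = [ h r ]
TransClosure-map f h (r ∷ rs) = h r ∷ TransClosure-map f h rs

-- If every vertex of a nonempty finite relation has a successor, then
-- following successors must revisit a vertex (pigeonhole), closing a cycle.
successors⇒cycle : ∀ {m} (R : Fin m → Fin m → Set) (s : Fin m → Fin m) →
  (∀ x → R x (s x)) → Fin m → ∃ λ x → TransClosure R x x
successors⇒cycle {m} R s step x₀ = iter i′ , subst (TransClosure R (iter i′)) closes (walk i′ d)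
  where
  iter : ℕ → Fin m
  iter zero    = x₀
  iter (suc i) = s (iter i)

  walk : ∀ i d → TransClosure R (iter i) (iter (d + suc i))
  walk i zero    = [ step (iter i) ]
  walk i (suc d) = walk i d ∷ʳ step (iter (d + suc i))

  collision = pigeonhole (ℕ.n<1+n m) (iter ∘ toℕ)
  i j : Fin (suc m)
  i = proj₁ collision
  j = proj₁ (proj₂ collision)
  i′ = toℕ i
  gap = ℕ.m≤n⇒∃[o]m+o≡n (proj₁ (proj₂ (proj₂ collision)))
  d = proj₁ gap

  closes : iter (d + suc i′) ≡ iter i′
  closes = trans (cong iter (trans (ℕ.+-comm d (suc i′)) (proj₂ gap)))
                 (sym (proj₂ (proj₂ (proj₂ collision))))

sink : ∀ {m} (R : Fin m → Fin m → Set) → Decidable R → IsAcyclic R →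
  Fin m → ∃ λ c → ∀ b → ¬ R c b
sink {m} R R? acyclic x₀ with any? (λ c → all? (λ b → ¬? (R? c b)))
... | yes found = found
... | no noSink = ⊥-elim (acyclic _ (proj₂ (successors⇒cycle R s step x₀)))
  where
  successor : ∀ c → ∃ λ b → R c b
  successor c with ¬∀⟶∃¬ m (λ b → ¬ R c b) (λ b → ¬? (R? c b)) (λ none → noSink (c , none))
  ... | b , ¬¬r = b , decidable-stable (R? c b) ¬¬r

  s : Fin m → Fin m
  s = proj₁ ∘ successor

  step : ∀ c → R c (s c)
  step = proj₂ ∘ successor

-- Topological sort: an acyclic decidable relation on Fin t admits an ordering
-- σ in which every step goes strictly downwards.  The sink is placed first
-- and the rest is ordered recursively.
topologicalOrder : ∀ t (R : Fin t → Fin t → Set) → Decidable R → IsAcyclic R →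
  Σ (Permutation′ t) λ σ → ∀ a b → R (σ ⟨$⟩ʳ a) (σ ⟨$⟩ʳ b) → b < a
topologicalOrder zero    R R? acyclic = idₚ , λ ()
topologicalOrder (suc t) R R? acyclic = σ , descending
  where
  c = sink R R? acyclic Fin.zero
  τ = transpose Fin.zero (proj₁ c)

  -- R on the vertices other than the sink, reindexed by Fin t
  rest : Fin t → Fin (suc t)
  rest a = τ ⟨$⟩ʳ Fin.suc a

  R′ : Fin t → Fin t → Set
  R′ a b = R (rest a) (rest b)

  order′ = topologicalOrder t R′ (λ a b → R? (rest a) (rest b))
                            (λ x cycle → acyclic _ (TransClosure-map rest id cycle))

  σ : Permutation′ (suc t)
  σ = lift₀ (proj₁ order′) ∘ₚ τ

  descending : ∀ a b → R (σ ⟨$⟩ʳ a) (σ ⟨$⟩ʳ b) → b < a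
  descending Fin.zero    b          r = ⊥-elim (proj₂ c _ r)
  descending (Fin.suc a) Fin.zero   r = s≤s z≤n
  descending (Fin.suc a) (Fin.suc b) r = s≤s (proj₂ order′ a b r)

x∈⋃⁻ : ∀ {n} {x : Fin n} (ps : List (Subset n)) → x ∈ ⋃ ps → ∃ λ p → p ∈ₗ ps × x ∈ p
x∈⋃⁻ List.[]       x∈⊥ = ⊥-elim (∉⊥ x∈⊥)
x∈⋃⁻ (p List.∷ ps) x∈∪ with x∈p∪q⁻ p (⋃ ps) x∈∪
... | inj₁ x∈p = p , Any.here refl , x∈p
... | inj₂ x∈⋃ with x∈⋃⁻ ps x∈⋃
...   | q , q∈ps , x∈q = q , Any.there q∈ps , x∈q

∈-─ : ∀ {A : Set} {x y : A} {xs : List A} (x∈xs : x ∈ₗ xs) → y ∈ₗ xs → y ≢ x → y ∈ₗ (xs ─ x∈xs)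
∈-─ (Any.here refl) (Any.here refl) y≢x   = ⊥-elim (y≢x refl)
∈-─ (Any.here _)    (Any.there y∈)  _     = y∈
∈-─ (Any.there _)   (Any.here refl) _     = Any.here refl
∈-─ (Any.there x∈)  (Any.there y∈)  y≢x   = Any.there (∈-─ x∈ y∈ y≢x)

∣∣≤length : ∀ {n} {A : Set} (f : Fin n → A) → Injective _≡_ _≡_ f →
  (p : Subset n) (xs : List A) → (∀ {x} → x ∈ p → f x ∈ₗ xs) → ∣ p ∣ ≤ length xs
∣∣≤length f inj []            xs covered = z≤n
∣∣≤length f inj (outside ∷ p) xs covered =
  ∣∣≤length (f ∘ Fin.suc) (FinP.suc-injective ∘ inj) p xs (covered ∘ there)
∣∣≤length f inj (inside ∷ p) xs covered =
  ℕ.≤-trans (s≤s (∣∣≤length (f ∘ Fin.suc) (FinP.suc-injective ∘ inj) p (xs ─ f₀∈xs) covered′))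
            (ℕ.≤-reflexive (sym (length-removeAt′ xs _)))
  where
  f₀∈xs = covered here
  covered′ : ∀ {x} → x ∈ p → f (Fin.suc x) ∈ₗ (xs ─ f₀∈xs)
  covered′ x∈p = ∈-─ f₀∈xs (covered (there x∈p)) (λ e → FinP.0≢1+n (sym (inj e)))

count-above : ∀ {t} (j : Fin t) → length (filter (j <?_) (allFin t)) + suc (toℕ j) ≡ t
count-above {suc t} Fin.zero    = trans (ℕ.+-comm _ 1) (cong suc (all-above-zero id))
  where
  all-above-zero : ∀ {s u} (f : Fin s → Fin u) →
    length (filter (Fin.zero {u} <?_) (tabulate (Fin.suc ∘ f))) ≡ s
  all-above-zero {zero}  f = refl
  all-above-zero {suc s} f = cong suc (all-above-zero (f ∘ Fin.suc))
count-above {suc t} (Fin.suc j) =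
  trans (ℕ.+-suc _ _) (cong suc (trans (cong (_+ suc (toℕ j)) (shift id)) (count-above j)))
  where
  shift : ∀ {s} (f : Fin s → Fin t) →
    length (filter (Fin.suc j <?_) (tabulate (Fin.suc ∘ f))) ≡ length (filter (j <?_) (tabulate f))
  shift {zero}  f = refl
  shift {suc s} f with does (j <? f Fin.zero)
  ... | true  = cong suc (shift (f ∘ Fin.suc))
  ... | false = shift (f ∘ Fin.suc)

PreyArc : ∀ {m t} → Digraph m → (Fin t → Fin m) → Fin t → Fin t → Set
PreyArc D w a b = ArcRel D (w a) (w b)

preyArc-acyclic : ∀ {m t} (D : Digraph m) (w : Fin t → Fin m) → Acyclic D → IsAcyclic (PreyArc D w)
preyArc-acyclic D w acyclic a cycle = acyclic (w a) (TransClosure-map w id cycle)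

module _ {n k t} (C : Fin t → Subset n) (D : Digraph (n + k)) (w : Fin t → Fin (n + k))
         (arcs : ∀ i x → x ∈ C i → ArcRel D (x ↑ˡ k) (w i))
         (nonzero⇔prey : ∀ v → NonzeroInDeg D v ⇔ ∃ λ i → v ≡ w i) where

  inDegZero-or-prey : ∀ v → InDegZero D v ⊎ ∃ λ i → v ≡ w i
  inDegZero-or-prey v with all? (λ x → Arc D x v ≟ᵇ false)
  ... | yes inDeg0 = inj₁ inDeg0
  ... | no ¬inDeg0 with ¬∀⟶∃¬ (n + k) (λ x → Arc D x v ≡ false) (λ x → Arc D x v ≟ᵇ false) ¬inDeg0
  ...   | x , x↛v = inj₂ (Equivalence.to (nonzero⇔prey v) (x , ¬-not x↛v))

  module _ (σ : Permutation′ t) (descending : ∀ a b → PreyArc D w (σ ⟨$⟩ʳ a) (σ ⟨$⟩ʳ b) → b < a) where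

    -- A vertex of C_{σi} with i ≥ j that is a prey vertex w_{σa} has an arc to
    -- w_{σi}, so i < a and hence j < a.
    member-of-clique : ∀ {j i : Fin t} {x} → j ≤ᶠ i → x ∈ C (σ ⟨$⟩ʳ i) →
      InDegZero D (x ↑ˡ k) ⊎ ∃ λ a → j < a × x ↑ˡ k ≡ w (σ ⟨$⟩ʳ a)
    member-of-clique {j} {i} {x} j≤i x∈Ci with inDegZero-or-prey (x ↑ˡ k)
    ... | inj₁ inDeg0          = inj₁ inDeg0
    ... | inj₂ (prey , x≡prey) = inj₂ (a , ℕ.≤-<-trans j≤i i<a , x≡wσa)
      where
      a = σ ⟨$⟩ˡ prey
      x≡wσa : x ↑ˡ k ≡ w (σ ⟨$⟩ʳ a)
      x≡wσa = trans x≡prey (cong w (sym (inverseʳ σ)))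
      i<a : i < a
      i<a = descending a i (subst (λ v → ArcRel D v (w (σ ⟨$⟩ʳ i))) x≡wσa (arcs (σ ⟨$⟩ʳ i) x x∈Ci))

    union-member : ∀ (j : Fin t) {x} → x ∈ unionFrom (C ∘ (σ ⟨$⟩ʳ_)) j →
      InDegZero D (x ↑ˡ k) ⊎ ∃ λ a → j < a × x ↑ˡ k ≡ w (σ ⟨$⟩ʳ a)
    union-member j x∈U with x∈⋃⁻ (map (C ∘ (σ ⟨$⟩ʳ_)) (filter (j ≤?_) (allFin t))) x∈U
    ... | _ , Ci∈ , x∈Ci with ∈-map⁻ (C ∘ (σ ⟨$⟩ʳ_)) {xs = filter (j ≤?_) (allFin t)} Ci∈
    ...   | i , i∈ , refl = member-of-clique (proj₂ (∈-filter⁻ (j ≤?_) {xs = allFin t} i∈)) x∈Ci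

    -- Hence the union injects into the in-degree-0 vertices followed by the
    -- prey vertices w_{σa} with a > j.
    union-bound : ∀ (j : Fin t) →
      ∣ unionFrom (C ∘ (σ ⟨$⟩ʳ_)) j ∣ ≤ numInDegZero D + length (filter (j <?_) (allFin t))
    union-bound j =
      ℕ.≤-trans (∣∣≤length (_↑ˡ k) (λ {x y} → ↑ˡ-injective k x y) _ (primary ++ preyAbove) covered)
                (ℕ.≤-reflexive (trans (length-++ primary) (cong (numInDegZero D +_) (length-map _ above))))
      where
      primary = filter (λ v → all? (λ x → Arc D x v ≟ᵇ false)) (allFin (n + k))
      above = filter (j <?_) (allFin t)
      preyAbove = map (λ a → w (σ ⟨$⟩ʳ a)) above
      covered : ∀ {x} → x ∈ unionFrom (C ∘ (σ ⟨$⟩ʳ_)) j → x ↑ˡ k ∈ₗ primary ++ preyAbove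
      covered {x} x∈U with union-member j x∈U
      ... | inj₁ inDeg0            = ∈-++⁺ˡ (∈-filter⁺ _ (∈-allFin (x ↑ˡ k)) inDeg0)
      ... | inj₂ (a , j<a , x≡wσa) =
        ∈-++⁺ʳ primary (subst (_∈ₗ preyAbove) (sym x≡wσa) (∈-map⁺ _ (∈-filter⁺ _ (∈-allFin a) j<a)))

theorem3p2 : ∀ {n} (G : Graph n) (k p t : ℕ) (C : Fin t → Subset n) →
    IsCompetitionNumber G k → IsPrimaryPredatorIndex G k p →
    IsEffectiveCompetitionCover G k t C →
    Σ (Permutation′ t) λ σ → ∀ (j : Fin t) →
      ∣ unionFrom (λ i → C (σ ⟨$⟩ʳ i)) j ∣ + suc (toℕ j) ≤ p + t
theorem3p2 G k p t C _ (_ , _ , primary≤p) (_ , _ , _ , D , realizes , w , arcs , nonzero⇔prey) =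
  σ , bound
  where
  order = topologicalOrder t (PreyArc D w) (λ a b → Arc D (w a) (w b) ≟ᵇ true)
                           (preyArc-acyclic D w (proj₁ realizes))
  σ = proj₁ order

  bound : ∀ j → ∣ unionFrom (λ i → C (σ ⟨$⟩ʳ i)) j ∣ + suc (toℕ j) ≤ p + t
  bound j = begin
    ∣ unionFrom (λ i → C (σ ⟨$⟩ʳ i)) j ∣ + suc (toℕ j)
      ≤⟨ ℕ.+-monoˡ-≤ (suc (toℕ j)) (union-bound C D w arcs nonzero⇔prey σ (proj₂ order) j) ⟩
    numInDegZero D + length (filter (j <?_) (allFin t)) + suc (toℕ j)
      ≡⟨ ℕ.+-assoc (numInDegZero D) _ _ ⟩
    numInDegZero D + (length (filter (j <?_) (allFin t)) + suc (toℕ j))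
      ≡⟨ cong (numInDegZero D +_) (count-above j) ⟩
    numInDegZero D + t
      ≤⟨ ℕ.+-monoˡ-≤ t (primary≤p D realizes) ⟩
    p + t ∎
    where open ℕ.≤-Reasoning
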